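{- Let $p$ be a prime and let $a$ and $n$ be positive integers. If $n \equiv 0 \pmod{z(p)}$, then $p$ divides ${p^a n \choose n}_F$.
   Context: The Fibonacci sequence is $F_1=F_2=1$, $F_n=F_{n-1}+F_{n-2}$ for $n\ge 3$. For $m\ge 1$ and $1\le k\le m$ the Fibonomial coefficient is ${m \choose k}_F = \frac{F_1F_2\cdots F_m}{(F_1\cdots F_k)(F_1\cdots F_{m-k})}$ (an integer). $z(m)$, the rank of appearance of $m$, is the smallest positive integer $t$ with $m \mid F_t$. -}

module Defs where

open import Data.Nat using (ℕ; zero; suc; _+_; _*_; _∸_; _^_; _≤_; _<_; NonZero; >-nonZero)
open import Data.Nat.Properties using (*-mono-<)
open import Data.Nat.Divisibility using (_∣_)
open import Data.Nat.DivMod using (_/_)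
open import Data.Product using (_×_)

fib : ℕ → ℕ
fib zero = 0
fib (suc zero) = 1
fib (suc (suc n)) = fib (suc n) + fib n

fibonorial : ℕ → ℕ
fibonorial zero = 1
fibonorial (suc m) = fibonorial m * fib (suc m)

fib-pos : ∀ n → 0 < fib (suc n)
fib-pos zero = Data.Nat.s≤s Data.Nat.z≤n
fib-pos (suc n) = Data.Nat.Properties.≤-trans (fib-pos n) (Data.Nat.Properties.m≤m+n _ _)

fibonorial-pos : ∀ m → 0 < fibonorial m
fibonorial-pos zero = Data.Nat.s≤s Data.Nat.z≤n
fibonorial-pos (suc m) = *-mono-< (fibonorial-pos m) (fib-pos m)

fibonomial : ℕ → ℕ → ℕ
fibonomial m k = _/_ (fibonorial m) (fibonorial k * fibonorial (m ∸ k))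
  {{ >-nonZero (*-mono-< (fibonorial-pos k) (fibonorial-pos (m ∸ k))) }}

IsRankOfAppearance : ℕ → ℕ → Set
IsRankOfAppearance m t = (0 < t) × (m ∣ fib t) × (∀ s → 0 < s → m ∣ fib s → t ≤ s)

module Submission where

-- Write n = d + 1 and suppose p ∣ F_n (this follows from
-- z(p) ∣ n, since F_z ∣ F_n).  Working modulo a divisor q of F_n, the addition
-- formula F_{a+b+1} = F_{a+1} F_{b+1} + F_a F_b gives, by induction on j,
--     F_{(j+1)n} = F_n · Q_j   with   Q_j ≡ (j+1) F_d^j   (mod q),
-- together with F_{d+jn} ≡ F_d^{j+1} (mod q).  Taking q = p and j + 1 = p^a shows
-- that p divides the quotient Q = F_{p^a n} / F_n.  On the other hand the
-- Fibonomial coefficients are integers, and peeling the top factor F_{p^a n}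
-- off the Fibonorial exhibits Q as a divisor of (p^a n choose n)_F.

open import Defs
open import Data.Nat using (ℕ; zero; suc; _+_; _*_; _∸_; _^_; _<_; pred; >-nonZero)
open import Data.Nat.Properties
  using (+-identityʳ; +-suc; *-identityˡ; *-identityʳ; *-comm; *-mono-<; m+n∸m≡n; suc-pred; m^n≢0)
open import Data.Nat.Divisibility
  using (_∣_; divides; ∣-reflexive; ∣-refl; ∣-trans; ∣m∣n⇒∣m+n; ∣m⇒∣m*n; m∣m*n; n∣m*n; _∣0; *-pres-∣; *-monoˡ-∣; m*n∣o⇒m∣o/n)
open import Data.Nat.Primality using (Prime; prime⇒nonZero)
open import Data.Product using (∃-syntax; _,_)
open import Relation.Binary.PropositionalEquality
  using (_≡_; refl; sym; trans; cong; subst; module ≡-Reasoning)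
open import Data.Nat.Tactic.RingSolver using (solve-∀)

fib-add : ∀ a b → fib (suc (a + b)) ≡ fib (suc a) * fib (suc b) + fib a * fib b
fib-add zero b = sym (trans (cong (_+ 0) (*-identityˡ (fib (suc b)))) (+-identityʳ _))
fib-add (suc a) b = begin
  fib (suc (suc a + b))                                      ≡⟨ cong (λ x → fib (suc x)) (sym (+-suc a b)) ⟩
  fib (suc (a + suc b))                                      ≡⟨ fib-add a (suc b) ⟩
  fib (suc a) * (fib (suc b) + fib b) + fib a * fib (suc b)  ≡⟨ regroup (fib (suc a)) (fib a) (fib (suc b)) (fib b) ⟩
  (fib (suc a) + fib a) * fib (suc b) + fib (suc a) * fib b  ∎
  where
  open ≡-Reasoning
  regroup : ∀ x y u v → x * (u + v) + y * u ≡ (x + y) * u + x * v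
  regroup = solve-∀

-- Fibonomial coefficients are integers: F_1⋯F_i · F_1⋯F_j divides F_1⋯F_{i+j}.
-- Induction via F_{i+j+2} = F_{i+1} F_{j+2} + F_i F_{j+1}, the Fibonacci
-- analogue of Pascal's rule.
fibonorial-∣ : ∀ i j → fibonorial i * fibonorial j ∣ fibonorial (i + j)
fibonorial-∣ zero j = ∣-reflexive (*-identityˡ (fibonorial j))
fibonorial-∣ (suc i) zero =
  ∣-reflexive (trans (*-identityʳ _) (cong fibonorial (sym (+-identityʳ (suc i)))))
fibonorial-∣ (suc i) (suc j) =
  subst (fibonorial (suc i) * fibonorial (suc j) ∣_) (sym expand)
        (∣m∣n⇒∣m+n (∣m⇒∣m*n (fib (suc (suc j))) left) (∣m⇒∣m*n (fib i) right))
  where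
  open ≡-Reasoning
  X = fibonorial (i + suc j)
  expand : fibonorial (suc i + suc j) ≡ X * fib (suc i) * fib (suc (suc j)) + X * fib (suc j) * fib i
  expand = begin
    X * fib (suc (i + suc j))                                    ≡⟨ cong (X *_) (fib-add i (suc j)) ⟩
    X * (fib (suc i) * fib (suc (suc j)) + fib i * fib (suc j))  ≡⟨ distribute X _ _ _ _ ⟩
    X * fib (suc i) * fib (suc (suc j)) + X * fib (suc j) * fib i ∎
    where
    distribute : ∀ x a b c e → x * (a * b + c * e) ≡ x * a * b + x * e * c
    distribute = solve-∀
  left : fibonorial (suc i) * fibonorial (suc j) ∣ X * fib (suc i)
  left = subst (_∣ X * fib (suc i)) (swap (fibonorial i) (fibonorial (suc j)) (fib (suc i)))
               (*-monoˡ-∣ (fib (suc i)) (fibonorial-∣ i (suc j)))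
    where
    swap : ∀ x y z → x * y * z ≡ x * z * y
    swap = solve-∀
  right : fibonorial (suc i) * fibonorial (suc j) ∣ X * fib (suc j)
  right = subst (λ m → fibonorial (suc i) * fibonorial (suc j) ∣ fibonorial m * fib (suc j))
                (sym (+-suc i j))
                (subst (_∣ fibonorial (suc i + j) * fib (suc j)) (reassoc (fibonorial (suc i)) (fibonorial j) (fib (suc j)))
                       (*-monoˡ-∣ (fib (suc j)) (fibonorial-∣ (suc i) j)))
    where
    reassoc : ∀ x y z → x * y * z ≡ x * (y * z)
    reassoc = solve-∀

-- Absorption: if F_{k+1} · Q = F_{k+1+l}, then Q divides (k+1+l choose k+1)_F.
-- Peel off the top factor F_{k+1+l} and use integrality of (k+l choose k)_F.
absorption : ∀ k l Q → fib (suc k) * Q ≡ fib (suc k + l) → Q ∣ fibonomial (suc k + l) (suc k)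
absorption k l Q top =
  m*n∣o⇒m∣o/n Q (fibonorial (suc k) * fibonorial (suc k + l ∸ suc k))
    {{ >-nonZero (*-mono-< (fibonorial-pos (suc k)) (fibonorial-pos (suc k + l ∸ suc k))) }}
    (subst (λ m → Q * (fibonorial (suc k) * fibonorial m) ∣ fibonorial (suc k + l))
           (sym (m+n∸m≡n (suc k) l))
           (subst (_∣ fibonorial (suc k + l)) (rearrange (fibonorial k) (fibonorial l) (fib (suc k)) Q)
                  (*-pres-∣ (fibonorial-∣ k l) (∣-reflexive top))))
  where
  rearrange : ∀ a b f q → a * b * (f * q) ≡ q * (a * f * b)
  rearrange = solve-∀

-- One-sided congruence: x is y plus a multiple of q (so x ≡ y mod q, x ≥ y).
infix 4 _≈_[mod_]
_≈_[mod_] : ℕ → ℕ → ℕ → Set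
x ≈ y [mod q ] = ∃[ r ] x ≡ y + r * q

≈-refl : ∀ {q} x → x ≈ x [mod q ]
≈-refl x = 0 , sym (+-identityʳ x)

∣⇒≈0 : ∀ {q x} → q ∣ x → x ≈ 0 [mod q ]
∣⇒≈0 (divides t eq) = t , eq

≈-resp-≡ : ∀ {q x y y'} → y ≡ y' → x ≈ y [mod q ] → x ≈ y' [mod q ]
≈-resp-≡ refl h = h

≈-+ : ∀ {q x y x' y'} → x ≈ y [mod q ] → x' ≈ y' [mod q ] → x + x' ≈ y + y' [mod q ]
≈-+ {q} {y = y} {y' = y'} (r , refl) (r' , refl) = r + r' , shuffle y y' r r' q
  where
  shuffle : ∀ y y' r r' q → y + r * q + (y' + r' * q) ≡ y + y' + (r + r') * q
  shuffle = solve-∀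

≈-* : ∀ {q x y x' y'} → x ≈ y [mod q ] → x' ≈ y' [mod q ] → x * x' ≈ y * y' [mod q ]
≈-* {q} {y = y} {y' = y'} (r , refl) (r' , refl) =
  r * y' + y * r' + r * r' * q , expand y y' r r' q
  where
  expand : ∀ y y' r r' q → (y + r * q) * (y' + r' * q) ≡ y * y' + (r * y' + y * r' + r * r' * q) * q
  expand = solve-∀

≈-∣ : ∀ {q x y} → x ≈ y [mod q ] → q ∣ y → q ∣ x
≈-∣ (r , refl) q∣y = ∣m∣n⇒∣m+n q∣y (n∣m*n r)

record FibAtMultiple (q d j : ℕ) : Set where
  field
    quotient      : ℕ
    factor        : fib (suc j * suc d) ≡ fib (suc d) * quotient
    quotient≈     : quotient ≈ suc j * fib d ^ j [mod q ]
    predecessor≈  : fib (d + j * suc d) ≈ fib d ^ suc j [mod q ]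

-- Induction on j; the predecessor congruence feeds the quotient congruence.  With m = jn, B = F_{n+m} and A = F_{d+m}, the addition formula
-- gives F_{n+(n+m)} = F_n (B + A) + F_d B and F_{d+(n+m)} = F_n B + F_d A, so the
-- new quotient is F_n Q + A + F_d Q ≡ F_d^{j+1} + F_d (j+1) F_d^j.
fib-at-multiple : ∀ {q} d → q ∣ fib (suc d) → ∀ j → FibAtMultiple q d j
fib-at-multiple {q} d q∣F zero = record
  { quotient     = 1
  ; factor       = trans (cong fib (+-identityʳ (suc d))) (sym (*-identityʳ (fib (suc d))))
  ; quotient≈    = ≈-refl 1
  ; predecessor≈ = ≈-resp-≡ (sym (*-identityʳ (fib d)))
                            (subst (_≈ fib d [mod q ]) (cong fib (sym (+-identityʳ d))) (≈-refl (fib d)))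
  }
fib-at-multiple {q} d q∣F (suc j) = record
  { quotient     = F * Q + A + D * Q
  ; factor       = trans (fib-add d (n + m)) factorise
  ; quotient≈    = ≈-resp-≡ collect
                     (≈-+ (≈-+ (≈-* F≈0 quotient≈) predecessor≈) (≈-* (≈-refl D) quotient≈))
  ; predecessor≈ = subst (_≈ D ^ suc (suc j) [mod q ]) (sym shifted)
                     (≈-+ (≈-* F≈0 (≈-refl (fib (n + m)))) (≈-* (≈-refl D) predecessor≈))
  }
  where
  open FibAtMultiple (fib-at-multiple d q∣F j)
  open ≡-Reasoning
  n = suc d
  m = j * n
  F = fib n
  D = fib d
  Q = quotient
  A = fib (d + m)
  F≈0 : F ≈ 0 [mod q ]
  F≈0 = ∣⇒≈0 q∣F
  factorise : F * (fib (n + m) + A) + D * fib (n + m) ≡ F * (F * Q + A + D * Q)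
  factorise = begin
    F * (fib (n + m) + A) + D * fib (n + m)  ≡⟨ cong (λ B → F * (B + A) + D * B) factor ⟩
    F * (F * Q + A) + D * (F * Q)            ≡⟨ pull F Q A D ⟩
    F * (F * Q + A + D * Q)                  ∎
    where
    pull : ∀ f x a e → f * (f * x + a) + e * (f * x) ≡ f * (f * x + a + e * x)
    pull = solve-∀
  collect : D * D ^ j + D * (suc j * D ^ j) ≡ suc (suc j) * D ^ suc j
  collect = tidy D (D ^ j) j
    where
    tidy : ∀ e y k → e * y + e * ((1 + k) * y) ≡ (2 + k) * (e * y)
    tidy = solve-∀
  shifted : fib (d + (n + m)) ≡ F * fib (n + m) + D * A
  shifted = trans (cong fib (+-suc d (d + m))) (fib-add d (d + m))

fib-∣-multiple : ∀ k n → fib n ∣ fib (k * n)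
fib-∣-multiple zero n = fib n ∣0
fib-∣-multiple (suc k) zero = subst (λ m → 0 ∣ fib m) (sym (*-comm (suc k) 0)) ∣-refl
fib-∣-multiple (suc k) (suc d) = divides quotient (trans factor (*-comm (fib (suc d)) quotient))
  where open FibAtMultiple (fib-at-multiple d ∣-refl k)

corollary13 : (p a n : ℕ) → Prime p → 0 < a → 0 < n →
              (z : ℕ) → IsRankOfAppearance p z → z ∣ n →
              p ∣ fibonomial (p ^ a * n) n
corollary13 p a@(suc b) (suc d) p-prime _ _ z (_ , p∣Fz , _) (divides c n≡cz) =
  subst (λ m → p ∣ fibonomial (m * n) n) j+1≡p^a
        (∣-trans p∣Q (absorption d (j * n) quotient (sym factor)))
  where
  n = suc d
  instance _ = prime⇒nonZero p-prime
  j = pred (p ^ a)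
  j+1≡p^a : suc j ≡ p ^ a
  j+1≡p^a = suc-pred (p ^ a) {{m^n≢0 p a}}
  -- p ∣ F_z ∣ F_n, so the congruence for F at multiples of n applies with q = p.
  p∣Fn : p ∣ fib n
  p∣Fn = ∣-trans p∣Fz (subst (λ m → fib z ∣ fib m) (sym n≡cz) (fib-∣-multiple c z))
  open FibAtMultiple (fib-at-multiple d p∣Fn j)
  -- Q ≡ p^a F_d^j (mod p), hence p ∣ Q.
  p∣Q : p ∣ quotient
  p∣Q = ≈-∣ quotient≈ (∣m⇒∣m*n (fib d ^ j) (subst (p ∣_) (sym j+1≡p^a) (m∣m*n (p ^ b))))
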